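{- Let $G\in\mathfrak{D}$, $H\in\mathfrak{D}_r$, $\zeta\in\mathcal{H}(G,H)$, and let $\alpha$ be a $\zeta$-selecting arc weight of $G$ within $\mathcal{H}(G,H)$. Then $\nu\mapsto\#\mathcal{H}(G(\alpha)_\nu,H)$ is an exponential function with exponent $\nu$ whose leading term is $(i_\zeta,\pi_\alpha(\zeta))$, where $i_\zeta$ is the number of homomorphisms $\xi\in\mathcal{H}(G,H)$ with $\iota_{\xi,D(\alpha)}=\iota_{\zeta,D(\alpha)}$.
   Context: A digraph $G=(V(G),A(G))$ has finite nonempty vertex set and arc set $A(G)\subseteq V(G)\times V(G)$; $vw$ denotes $(v,w)$; $G^*$ is $G$ with loops removed. $\mathfrak{D}$: all digraphs; $\mathfrak{D}_r$: reflexive digraphs; $\mathcal{H}(G,H)$: homomorphisms. An arc weight of $G$ is $\alpha:A(G^*)\to\mathbb{N}_0$; $D(\alpha)=\{vw:\alpha(v,w)>0\}$. $[v,w]_H=\{u:vu,uw\in A(H)\}$, $\iota(v,w)_H=\#[v,w]_H$; for $\xi\in\mathcal{H}(G,H)$, $\iota_\xi(v,w)=\iota(\xi(v),\xi(w))_H$, $\iota_{\xi,B}$ its restriction to $B\subseteq A(G^*)$, $\pi_\alpha(\xi)=\prod_{vw\in A(G^*)}\iota_\xi(v,w)^{\alpha(v,w)}$. $\alpha$ is $\zeta$-selecting within $\mathcal{H}(G,H)$ if for all $\xi\in\mathcal{H}(G,H)$, $\pi_\alpha(\xi)\le\pi_\alpha(\zeta)$ with equality iff $\iota_{\xi,D(\alpha)}=\iota_{\zeta,D(\alpha)}$.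 $G(\alpha)_\nu$ ($\nu\in\mathbb{N}_0$): take pairwise disjoint sets $X_\nu(v,w)$ disjoint from $V(G)$ with $\#X_\nu(v,w)=\nu\alpha(v,w)$; vertex set $V(G)\cup\bigcup_{vw\in D(\alpha)}X_\nu(v,w)$, arc set $A(G)\cup\bigcup_{vw\in D(\alpha)}((\{v\}\times X_\nu(v,w))\cup(X_\nu(v,w)\times\{w\}))$. An exponential function is a map $f:\mathbb{N}_0\to\mathbb{R}$, $f(\nu)=\sum_{i=1}^I a_ix_i^\nu$ with $I\ge1$, $a_i>0$ and $0<x_1<\dots<x_I$; its leading term is $(a_I,x_I)$. -}

module Defs where

open import Data.Nat using (ℕ; zero; suc; _+_; _*_; _^_; _≤_; _<_; _<?_)
open import Data.Nat.Properties using (≤-trans; m≤m+n)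
open import Data.Fin as Fin using (Fin; zero; suc; splitAt; fromℕ; _≟_)
open import Data.Fin.Properties using (all?)
open import Data.Bool using (Bool; true; false; T; _∧_; not)
open import Data.List using (List; []; _∷_; map; concatMap; allFin; filter; length)
open import Data.Nat.ListAction using (sum; product)
open import Data.Product using (_×_; _,_; Σ)
open import Data.Sum using (_⊎_; inj₁; inj₂)
open import Relation.Nullary using (¬_; Dec; yes; no; does)
open import Relation.Nullary.Decidable using (T?; _→-dec_; _×-dec_)
open import Relation.Binary.PropositionalEquality using (_≡_)
import Data.Nat as ℕ

record Digraph : Set where
  field
    n        : ℕ
    nonempty : 0 < n
    arc      : Fin n → Fin n → Bool
open Digraph public

arc* : (G : Digraph) → Fin (n G) → Fin (n G) → Bool
arc* G v w = arc G v w ∧ not (does (v ≟ w))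

Reflexive : Digraph → Set
Reflexive H = ∀ v → T (arc H v v)

IsHom : (G H : Digraph) → (Fin (n G) → Fin (n H)) → Set
IsHom G H ξ = ∀ v w → T (arc G v w) → T (arc H (ξ v) (ξ w))

isHom? : (G H : Digraph) → (ξ : Fin (n G) → Fin (n H)) → Dec (IsHom G H ξ)
isHom? G H ξ = all? λ v → all? λ w → T? (arc G v w) →-dec T? (arc H (ξ v) (ξ w))

cons : ∀ {k m} → Fin m → (Fin k → Fin m) → Fin (suc k) → Fin m
cons i f zero    = i
cons i f (suc j) = f j

allFuns : (k m : ℕ) → List (Fin k → Fin m)
allFuns zero    m = (λ ()) ∷ []
allFuns (suc k) m = concatMap (λ f → map (λ i → cons i f) (allFin m)) (allFuns k m)

numHom : (G H : Digraph) → ℕ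
numHom G H = length (filter (isHom? G H) (allFuns (n G) (n H)))

ι : (H : Digraph) → Fin (n H) → Fin (n H) → ℕ
ι H v w = length (filter (λ u → T? (arc H v u ∧ arc H u w)) (allFin (n H)))

ιξ : (G H : Digraph) → (Fin (n G) → Fin (n H)) → Fin (n G) → Fin (n G) → ℕ
ιξ G H ξ v w = ι H (ξ v) (ξ w)

-- Arc weights: α : A(G*) → ℕ₀, represented as a function on all pairs
-- that vanishes outside A(G*).

record ArcWeight (G : Digraph) : Set where
  field
    wt      : Fin (n G) → Fin (n G) → ℕ
    support : ∀ v w → 0 < wt v w → T (arc* G v w)
open ArcWeight public

pairs : (k : ℕ) → List (Fin k × Fin k)
pairs k = concatMap (λ v → map (λ w → (v , w)) (allFin k)) (allFin k)

πα : (G H : Digraph) → ArcWeight G → (Fin (n G) → Fin (n H)) → ℕ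
πα G H α ξ = product (map f (pairs (n G)))
  where
  f : Fin (n G) × Fin (n G) → ℕ
  f (v , w) with arc* G v w
  ... | true  = ιξ G H ξ v w ^ wt α v w
  ... | false = 1

Agree : (G H : Digraph) → ArcWeight G → (ξ ζ : Fin (n G) → Fin (n H)) → Set
Agree G H α ξ ζ = ∀ v w → 0 < wt α v w → ιξ G H ξ v w ≡ ιξ G H ζ v w

agree? : (G H : Digraph) (α : ArcWeight G) (ξ ζ : Fin (n G) → Fin (n H)) → Dec (Agree G H α ξ ζ)
agree? G H α ξ ζ = all? λ v → all? λ w → (0 <? wt α v w) →-dec (ιξ G H ξ v w ℕ.≟ ιξ G H ζ v w)

Selecting : (G H : Digraph) → ArcWeight G → (ζ : Fin (n G) → Fin (n H)) → Set
Selecting G H α ζ = ∀ ξ → IsHom G H ξ →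
  (πα G H α ξ ≤ πα G H α ζ) ×
  ((πα G H α ξ ≡ πα G H α ζ → Agree G H α ξ ζ) × (Agree G H α ξ ζ → πα G H α ξ ≡ πα G H α ζ))

iζ : (G H : Digraph) → ArcWeight G → (ζ : Fin (n G) → Fin (n H)) → ℕ
iζ G H α ζ = length (filter (λ ξ → isHom? G H ξ ×-dec agree? G H α ξ ζ) (allFuns (n G) (n H)))

-- G(α)_ν : vertex set Fin (n + N), N = Σ_{vw} ν·α(v,w); the first n
-- vertices are V(G), the remaining ones are split into consecutive blocks
-- X_ν(v,w) of size ν·α(v,w), listed in the order of `pairs`.

blockTotal : ∀ {P : Set} → List P → (P → ℕ) → ℕ
blockTotal ps g = sum (map g ps)

locate : ∀ {P : Set} (ps : List P) (g : P → ℕ) → Fin (blockTotal ps g) → P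
locate []       g ()
locate (p ∷ ps) g i with splitAt (g p) i
... | inj₁ _ = p
... | inj₂ j = locate ps g j

extraSize : (G : Digraph) → ArcWeight G → ℕ → ℕ
extraSize G α ν = blockTotal (pairs (n G)) (λ { (v , w) → ν * wt α v w })

expand : (G : Digraph) → ArcWeight G → ℕ → Digraph
expand G α ν = record
  { n        = n G + N
  ; nonempty = ≤-trans (nonempty G) (m≤m+n (n G) N)
  ; arc      = λ x y → arc' (splitAt (n G) x) (splitAt (n G) y)
  }
  where
  N : ℕ
  N = extraSize G α ν
  blk : Fin N → Fin (n G) × Fin (n G)
  blk = locate (pairs (n G)) (λ { (v , w) → ν * wt α v w })
  arc' : Fin (n G) ⊎ Fin N → Fin (n G) ⊎ Fin N → Bool
  arc' (inj₁ a) (inj₁ b) = arc G a b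
  arc' (inj₁ a) (inj₂ x) with blk x
  ... | (v , w) = does (a ≟ v)
  arc' (inj₂ x) (inj₁ b) with blk x
  ... | (v , w) = does (b ≟ w)
  arc' (inj₂ _) (inj₂ _) = false

record ExpFunWithLeading (f : ℕ → ℕ) (a x : ℕ) : Set where
  field
    k        : ℕ                       -- I = suc k ≥ 1
    coef     : Fin (suc k) → ℕ
    base     : Fin (suc k) → ℕ
    coef-pos : ∀ i → 0 < coef i
    base-pos : ∀ i → 0 < base i
    base-inc : ∀ i j → i Fin.< j → base i < base j
    formula  : ∀ ν → f ν ≡ sum (map (λ i → coef i * base i ^ ν) (allFin (suc k)))
    lead-coef : coef (fromℕ k) ≡ a
    lead-base : base (fromℕ k) ≡ x

module Submission where

open import Defs
open import Data.Fin using (Fin)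

-- A homomorphism G(α)_ν → H is a homomorphism f : G → H together with an independent
-- choice, for every new vertex x ∈ X_ν(v,w), of an image in [f(v), f(w)]_H.  Hence
--   #𝓗(G(α)_ν, H) = Σ_{f ∈ 𝓗(G,H)} ∏_{vw} ι_f(v,w)^(ν·α(v,w)) = Σ_{f ∈ 𝓗(G,H)} π_α(f)^ν,
-- a power sum of the weights π_α(f).  Over a reflexive H all weights are positive; as α
-- is ζ-selecting, the largest weight is π_α(ζ), attained by exactly the i_ζ homomorphisms
-- agreeing with ζ on D(α).  Grouping equal weights turns such a power sum into an
-- exponential function whose leading term is (multiplicity of the maximum, maximum).

import Algebra.Properties.Semiring.Sum as FinSum
open import Algebra.Properties.CommutativeSemigroup using (interchange)
open import Data.Bool using (true; false; T; _∧_; if_then_else_)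
open import Data.Bool.Properties using (T-∧)
open import Data.Empty using (⊥-elim)
open import Data.Fin using (zero; suc; splitAt; _↑ˡ_; _↑ʳ_; _≟_)
open import Data.Fin.Properties using (splitAt-↑ˡ; splitAt-↑ʳ; all?)
open import Data.List using (List; []; _∷_; map; allFin; filter; length; tabulate; concatMap; _++_)
open import Data.List.Extrema.Nat using (min; min≤⊤; min≤xs; argmin-all)
open import Data.List.Membership.Propositional using (_∈_)
open import Data.List.Membership.Propositional.Properties using (∈-allFin; ∈-filter⁻)
open import Data.List.Properties
  using ( map-tabulate; map-cong; map-++; map-∘
        ; filter-some; filter-none; filter-notAll; filter-accept; filter-reject)
open import Data.List.Relation.Unary.All as All using (All)
open import Data.List.Relation.Unary.All.Properties
  using (filter⁺; all-filter) renaming (map⁺ to All-map⁺)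
open import Data.List.Relation.Unary.Any as Any using (Any; here; there)
open import Data.List.Relation.Unary.Any.Properties using (concat⁺; map⁺)
open import Data.Nat using (ℕ; zero; suc; _+_; _*_; _^_; _≤_; _<_; z<s; s≤s; >-nonZero)
open import Data.Nat.ListAction using (sum; product)
open import Data.Nat.ListAction.Properties using (sum-++)
open import Data.Nat.Properties
  using ( +-*-semiring; *-commutativeSemigroup; +-identityʳ; +-assoc; +-comm; *-assoc; *-comm
        ; *-distribˡ-+; *-zeroʳ; ^-zeroˡ; ^-*-assoc; m^n>0; *-mono-≤
        ; ≤-pred; ≤-refl; ≤-trans; ≤-antisym; ≤∧≢⇒<)
  renaming (_≟_ to _≟ℕ_)
open import Data.Product using (_×_; _,_; proj₁; proj₂; Σ-syntax)
open import Data.Sum using (inj₁; inj₂)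
import Data.Vec.Functional as V
open import Data.Vec.Functional.Properties using (lookup-++ˡ; lookup-++ʳ)
open import Function using (_∘_; id)
open import Function.Bundles using (Equivalence)
open import Relation.Binary.PropositionalEquality
  using (_≡_; _≢_; refl; sym; trans; cong; cong₂; subst; subst₂; module ≡-Reasoning)
open import Relation.Nullary using (¬_; Dec; yes; no; does; ¬?)
open import Relation.Nullary.Decidable using (_×-dec_; T?)

open FinSum +-*-semiring using (sum-syntax; ∑-distrib-+; sum-replicate-zero; *-distribʳ-sum; sum-cong-≗)

indicator : {A : Set} → Dec A → ℕ
indicator d = if does d then 1 else 0

indicator-yes : {A : Set} (d : Dec A) → A → indicator d ≡ 1
indicator-yes (yes _) _ = refl
indicator-yes (no ¬a) a = ⊥-elim (¬a a)

indicator-× : {A B : Set} (a : Dec A) (b : Dec B) → indicator (a ×-dec b) ≡ indicator a * indicator b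
indicator-× (yes _) (yes _) = refl
indicator-× (yes _) (no _)  = refl
indicator-× (no _)  _       = refl

indicator-⇔ : {A B : Set} (a : Dec A) (b : Dec B) → (A → B) → (B → A) → indicator a ≡ indicator b
indicator-⇔ (yes _) (yes _) _   _   = refl
indicator-⇔ (yes a) (no ¬b) a→b _   = ⊥-elim (¬b (a→b a))
indicator-⇔ (no ¬a) (yes b) _   b→a = ⊥-elim (¬a (b→a b))
indicator-⇔ (no _)  (no _)  _   _   = refl

length-filter-indicator : {A : Set} {P : A → Set} (d : ∀ x → Dec (P x)) (xs : List A) →
  length (filter d xs) ≡ sum (map (indicator ∘ d) xs)
length-filter-indicator d [] = refl
length-filter-indicator d (x ∷ xs) with d x
... | yes _ = cong suc (length-filter-indicator d xs)
... | no _  = length-filter-indicator d xs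

sum-filter : {A : Set} {P : A → Set} (d : ∀ x → Dec (P x)) (h : A → ℕ) (u : ℕ → ℕ)
  (xs : List A) →
  sum (map u (map h (filter d xs))) ≡ sum (map (λ x → indicator (d x) * u (h x)) xs)
sum-filter d h u [] = refl
sum-filter d h u (x ∷ xs) with d x
... | yes _ = cong₂ _+_ (sym (+-identityʳ (u (h x)))) (sum-filter d h u xs)
... | no _  = sum-filter d h u xs

sum-allFin : ∀ m (F : Fin m → ℕ) → sum (map F (allFin m)) ≡ ∑[ i < m ] F i
sum-allFin m F = trans (cong sum (map-tabulate id F)) (sum-tabulate m F)
  where
  sum-tabulate : ∀ m (F : Fin m → ℕ) → sum (tabulate F) ≡ ∑[ i < m ] F i
  sum-tabulate zero    F = refl
  sum-tabulate (suc m) F = cong (F zero +_) (sum-tabulate m (F ∘ suc))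

∑-sum-comm : ∀ m {A : Set} (X : Fin m → A → ℕ) (ys : List A) →
  ∑[ i < m ] sum (map (X i) ys) ≡ sum (map (λ y → ∑[ i < m ] X i y) ys)
∑-sum-comm m X []       = sum-replicate-zero m
∑-sum-comm m X (y ∷ ys) = trans (∑-distrib-+ (λ i → X i y) (λ i → sum (map (X i) ys)))
                                (cong (∑[ i < m ] X i y +_) (∑-sum-comm m X ys))

∏ : ∀ n → (Fin n → ℕ) → ℕ
∏ zero    F = 1
∏ (suc n) F = F zero * ∏ n (F ∘ suc)

infixl 10 ∏
syntax ∏ n (λ x → e) = ∏[ x < n ] e

∏-cong : ∀ n {F G : Fin n → ℕ} → (∀ x → F x ≡ G x) → ∏ n F ≡ ∏ n G
∏-cong zero    F≡G = refl
∏-cong (suc n) F≡G = cong₂ _*_ (F≡G zero) (∏-cong n (F≡G ∘ suc))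

∏-+ : ∀ a b (F : Fin (a + b) → ℕ) →
  ∏ (a + b) F ≡ ∏ a (F ∘ (_↑ˡ b)) * ∏ b (F ∘ (a ↑ʳ_))
∏-+ zero    b F = sym (+-identityʳ (∏ b F))
∏-+ (suc a) b F = trans (cong (F zero *_) (∏-+ a b (F ∘ suc))) (sym (*-assoc (F zero) _ _))

∏-const : ∀ n x → ∏[ _ < n ] x ≡ x ^ n
∏-const zero    x = refl
∏-const (suc n) x = cong (x *_) (∏-const n x)

∏-indicator : ∀ n {P : Fin n → Set} (d : ∀ x → Dec (P x)) (D : Dec (∀ x → P x)) →
  ∏ n (indicator ∘ d) ≡ indicator D
∏-indicator zero    d D = sym (indicator-yes D (λ ()))
∏-indicator (suc n) {P} d D = begin
  indicator (d zero) * ∏ n (indicator ∘ d ∘ suc)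
    ≡⟨ cong (indicator (d zero) *_) (∏-indicator n (d ∘ suc) tail?) ⟩
  indicator (d zero) * indicator tail?
    ≡⟨ sym (indicator-× (d zero) tail?) ⟩
  indicator (d zero ×-dec tail?)
    ≡⟨ indicator-⇔ (d zero ×-dec tail?) D (λ { (p₀ , p) zero → p₀ ; (p₀ , p) (suc x) → p x })
                                          (λ p → p zero , p ∘ suc) ⟩
  indicator D ∎
  where
  open ≡-Reasoning
  tail? : Dec (∀ x → P (suc x))
  tail? = all? (d ∘ suc)

sum-concatMap : {A B : Set} (w : B → ℕ) (g : A → List B) (xs : List A) →
  sum (map w (concatMap g xs)) ≡ sum (map (λ x → sum (map w (g x))) xs)
sum-concatMap w g []       = refl
sum-concatMap w g (x ∷ xs) = begin
  sum (map w (g x ++ concatMap g xs))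
    ≡⟨ cong sum (map-++ w (g x) (concatMap g xs)) ⟩
  sum (map w (g x) ++ map w (concatMap g xs))
    ≡⟨ sum-++ (map w (g x)) _ ⟩
  sum (map w (g x)) + sum (map w (concatMap g xs))
    ≡⟨ cong (sum (map w (g x)) +_) (sum-concatMap w g xs) ⟩
  sum (map w (g x)) + sum (map (λ x → sum (map w (g x))) xs) ∎
  where open ≡-Reasoning

sum-*ˡ : {A : Set} (c : ℕ) (w : A → ℕ) (xs : List A) →
  sum (map (λ x → c * w x) xs) ≡ c * sum (map w xs)
sum-*ˡ c w []       = sym (*-zeroʳ c)
sum-*ˡ c w (x ∷ xs) = trans (cong (c * w x +_) (sum-*ˡ c w xs)) (sym (*-distribˡ-+ c (w x) _))

Σmaps : ∀ k m → ((Fin k → Fin m) → ℕ) → ℕ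
Σmaps k m w = sum (map w (allFuns k m))

Extensional : ∀ {k m} → ((Fin k → Fin m) → ℕ) → Set
Extensional w = ∀ f g → (∀ x → f x ≡ g x) → w f ≡ w g

Σmaps-cong : ∀ k m {w w′ : (Fin k → Fin m) → ℕ} → (∀ f → w f ≡ w′ f) →
  Σmaps k m w ≡ Σmaps k m w′
Σmaps-cong k m w≡w′ = cong sum (map-cong w≡w′ (allFuns k m))

Σmaps-*ˡ : ∀ k m c (w : (Fin k → Fin m) → ℕ) → Σmaps k m (λ f → c * w f) ≡ c * Σmaps k m w
Σmaps-*ˡ k m c w = sum-*ˡ c w (allFuns k m)

Σmaps-suc : ∀ k m w → Σmaps (suc k) m w ≡ Σmaps k m (λ f → ∑[ i < m ] w (cons i f))
Σmaps-suc k m w = trans (sum-concatMap w (λ f → map (λ i → cons i f) (allFin m)) (allFuns k m))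
  (Σmaps-cong k m λ f → trans (cong sum (sym (map-∘ (allFin m))))
                              (sum-allFin m (λ i → w (cons i f))))

cons-++ : ∀ {m} k {l} (i : Fin m) (f : Fin k → Fin m) (g : Fin l → Fin m) (x : Fin (suc k + l)) →
  (cons i f V.++ g) x ≡ cons i (f V.++ g) x
cons-++ k i f g zero = refl
cons-++ k i f g (suc x) with splitAt k x
... | inj₁ _ = refl
... | inj₂ _ = refl

Σmaps-++ : ∀ k l m (w : (Fin (k + l) → Fin m) → ℕ) → Extensional w →
  Σmaps (k + l) m w ≡ Σmaps k m (λ f → Σmaps l m (λ g → w (f V.++ g)))
Σmaps-++ zero    l m w ext = sym (+-identityʳ (Σmaps l m w))
Σmaps-++ (suc k) l m w ext = begin
  Σmaps (suc (k + l)) m w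
    ≡⟨ Σmaps-suc (k + l) m w ⟩
  Σmaps (k + l) m (λ h → ∑[ i < m ] w (cons i h))
    ≡⟨ Σmaps-++ k l m (λ h → ∑[ i < m ] w (cons i h)) ext-cons ⟩
  Σmaps k m (λ f → Σmaps l m (λ g → ∑[ i < m ] w (cons i (f V.++ g))))
    ≡⟨ Σmaps-cong k m (λ f → sym (∑-sum-comm m (λ i g → w (cons i (f V.++ g))) (allFuns l m))) ⟩
  Σmaps k m (λ f → ∑[ i < m ] Σmaps l m (λ g → w (cons i (f V.++ g))))
    ≡⟨ Σmaps-cong k m (λ f → sum-cong-≗ λ i → Σmaps-cong l m λ g →
         ext _ _ (λ x → sym (cons-++ k i f g x))) ⟩
  Σmaps k m (λ f → ∑[ i < m ] Σmaps l m (λ g → w (cons i f V.++ g)))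
    ≡⟨ sym (Σmaps-suc k m (λ f → Σmaps l m (λ g → w (f V.++ g)))) ⟩
  Σmaps (suc k) m (λ f → Σmaps l m (λ g → w (f V.++ g))) ∎
  where
  open ≡-Reasoning
  ext-cons : Extensional (λ h → ∑[ i < m ] w (cons i h))
  ext-cons f g f≗g = sum-cong-≗ λ i →
    ext (cons i f) (cons i g) λ { zero → refl ; (suc x) → f≗g x }

Σmaps-∏ : ∀ l m (h : Fin l → Fin m → ℕ) →
  Σmaps l m (λ g → ∏[ x < l ] h x (g x)) ≡ ∏[ x < l ] ∑[ i < m ] h x i
Σmaps-∏ zero    m h = refl
Σmaps-∏ (suc l) m h = begin
  Σmaps (suc l) m (λ g → ∏[ x < suc l ] h x (g x))
    ≡⟨ Σmaps-suc l m _ ⟩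
  Σmaps l m (λ g → ∑[ i < m ] (h zero i * rest g))
    ≡⟨ Σmaps-cong l m (λ g → sym (*-distribʳ-sum (rest g) (h zero))) ⟩
  Σmaps l m (λ g → (∑[ i < m ] h zero i) * rest g)
    ≡⟨ Σmaps-*ˡ l m (∑[ i < m ] h zero i) rest ⟩
  (∑[ i < m ] h zero i) * Σmaps l m rest
    ≡⟨ cong ((∑[ i < m ] h zero i) *_) (Σmaps-∏ l m (h ∘ suc)) ⟩
  ∏[ x < suc l ] ∑[ i < m ] h x i ∎
  where
  open ≡-Reasoning
  rest : (Fin l → Fin m) → ℕ
  rest g = ∏[ x < l ] h (suc x) (g x)

allFuns-complete : ∀ k m (f : Fin k → Fin m) → Any (λ g → ∀ x → g x ≡ f x) (allFuns k m)
allFuns-complete zero    m f = here (λ ())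
allFuns-complete (suc k) m f = concat⁺ (map⁺ (Any.map extend (allFuns-complete k m (f ∘ suc))))
  where
  extend : ∀ {g} → (∀ x → g x ≡ f (suc x)) →
           Any (λ h → ∀ x → h x ≡ f x) (map (λ i → cons i g) (allFin m))
  extend g≗ = map⁺ (Any.map (λ { refl → λ { zero → refl ; (suc x) → g≗ x } })
                            (∈-allFin (f zero)))

∏-blocks : {P : Set} (ps : List P) (g h : P → ℕ) →
  ∏[ x < blockTotal ps g ] h (locate ps g x) ≡ product (map (λ p → h p ^ g p) ps)
∏-blocks []       g h = refl
∏-blocks (p ∷ ps) g h = begin
  ∏ (g p + rest) (h ∘ locate (p ∷ ps) g)
    ≡⟨ ∏-+ (g p) rest _ ⟩
  ∏[ i < g p ] h (locate (p ∷ ps) g (i ↑ˡ rest)) * ∏[ j < rest ] h (locate (p ∷ ps) g (g p ↑ʳ j))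
    ≡⟨ cong₂ _*_ (trans (∏-cong (g p) in-first) (∏-const (g p) (h p)))
                 (trans (∏-cong rest in-rest) (∏-blocks ps g h)) ⟩
  h p ^ g p * product (map (λ p → h p ^ g p) ps) ∎
  where
  open ≡-Reasoning
  rest : ℕ
  rest = blockTotal ps g
  in-first : ∀ i → h (locate (p ∷ ps) g (i ↑ˡ rest)) ≡ h p
  in-first i rewrite splitAt-↑ˡ (g p) i rest = refl
  in-rest : ∀ j → h (locate (p ∷ ps) g (g p ↑ʳ j)) ≡ h (locate ps g j)
  in-rest j rewrite splitAt-↑ʳ (g p) rest j = refl

product-^ : {A : Set} (F : A → ℕ) (ν : ℕ) (xs : List A) →
  product (map (λ x → F x ^ ν) xs) ≡ product (map F xs) ^ ν
product-^ F ν []       = sym (^-zeroˡ ν)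
product-^ F ν (x ∷ xs) = trans (cong (F x ^ ν *_) (product-^ F ν xs)) (sym (*-^ (F x) _ ν))
  where
  *-^ : ∀ a b ν → (a * b) ^ ν ≡ a ^ ν * b ^ ν
  *-^ a b zero    = refl
  *-^ a b (suc ν) = trans (cong (a * b *_) (*-^ a b ν))
                          (interchange *-commutativeSemigroup a b (a ^ ν) (b ^ ν))

contribution : (G H : Digraph) → ArcWeight G → (Fin (n G) → Fin (n H)) → Fin (n G) × Fin (n G) → ℕ
contribution G H α ξ (v , w) = ιξ G H ξ v w ^ wt α v w

wt-off-arcs : (G : Digraph) (α : ArcWeight G) (v w : Fin (n G)) → arc* G v w ≡ false → wt α v w ≡ 0
wt-off-arcs G α v w no-arc with wt α v w in eq
... | zero  = refl
... | suc _ = ⊥-elim (subst T no-arc (support α v w (subst (0 <_) (sym eq) z<s)))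

-- Defs writes π_α(ξ) as the product over all pairs of a function local to its
-- definition; factorOf names that function by matching the shape product (map F xs).
factorOf : {A : Set} {xs : List A} {F : A → ℕ} → product (map F xs) ≡ product (map F xs) → A → ℕ
factorOf {F = F} _ = F

-- π_α(ξ) is the product of the contributions of all pairs: off A(G*) the
-- contribution is ι^0 = 1, matching the factor 1 used by the definition.
πα-formula : (G H : Digraph) (α : ArcWeight G) (ξ : Fin (n G) → Fin (n H)) →
  πα G H α ξ ≡ product (map (contribution G H α ξ) (pairs (n G)))
πα-formula G H α ξ = cong product (map-cong factor≡contribution (pairs (n G)))
  where
  factor≡contribution : ∀ p →
    factorOf {xs = pairs (n G)} (refl {x = πα G H α ξ}) p ≡ contribution G H α ξ p
  factor≡contribution (v , w) with arc* G v w in eq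
  ... | true  = refl
  ... | false = cong (ιξ G H ξ v w ^_) (sym (wt-off-arcs G α v w eq))

IsHom-resp : (G H : Digraph) {f g : Fin (n G) → Fin (n H)} →
  (∀ x → f x ≡ g x) → IsHom G H f → IsHom G H g
IsHom-resp G H f≗g homf a b ab = subst₂ (λ y z → T (arc H y z)) (f≗g a) (f≗g b) (homf a b ab)

hom-indicator-extensional : (G H : Digraph) → Extensional (λ f → indicator (isHom? G H f))
hom-indicator-extensional G H f g f≗g =
  indicator-⇔ (isHom? G H f) (isHom? G H g) (IsHom-resp G H f≗g) (IsHom-resp G H (sym ∘ f≗g))

Between : (H : Digraph) → Fin (n H) → Fin (n H) → Fin (n H) → Set
Between H a b u = T (arc H a u ∧ arc H u b)

between? : (H : Digraph) (a b u : Fin (n H)) → Dec (Between H a b u)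
between? H a b u = T? (arc H a u ∧ arc H u b)

ι-as-sum : (H : Digraph) (a b : Fin (n H)) → ι H a b ≡ ∑[ u < n H ] indicator (between? H a b u)
ι-as-sum H a b = trans (length-filter-indicator (between? H a b) (allFin (n H)))
                       (sum-allFin (n H) (indicator ∘ between? H a b))

decided : {A : Set} (d : Dec A) → A → T (does d)
decided (yes _) _ = _
decided (no ¬a) a = ¬a a

sound : {A : Set} (d : Dec A) → T (does d) → A
sound (yes a) _ = a

module Expansion (G H : Digraph) (α : ArcWeight G) (ν : ℕ) where

  E : Digraph
  E = expand G α ν

  N : ℕ
  N = extraSize G α ν

  blockSize : Fin (n G) × Fin (n G) → ℕ
  blockSize p = ν * wt α (proj₁ p) (proj₂ p)

  block : Fin N → Fin (n G) × Fin (n G)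
  block = locate (pairs (n G)) blockSize

  source target : Fin N → Fin (n G)
  source x = proj₁ (block x)
  target x = proj₂ (block x)

  old-arc : ∀ a b → T (arc G a b) → T (arc E (a ↑ˡ N) (b ↑ˡ N))
  old-arc a b ab rewrite splitAt-↑ˡ (n G) a N | splitAt-↑ˡ (n G) b N = ab

  arc-into : ∀ x → T (arc E (source x ↑ˡ N) (n G ↑ʳ x))
  arc-into x rewrite splitAt-↑ˡ (n G) (source x) N | splitAt-↑ʳ (n G) N x =
    decided (source x ≟ source x) refl

  arc-out-of : ∀ x → T (arc E (n G ↑ʳ x) (target x ↑ˡ N))
  arc-out-of x rewrite splitAt-↑ˡ (n G) (target x) N | splitAt-↑ʳ (n G) N x =
    decided (target x ≟ target x) refl

  module _ (f : Fin (n G) → Fin (n H)) (g : Fin N → Fin (n H)) where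

    InBlocks : Set
    InBlocks = ∀ x → Between H (f (source x)) (f (target x)) (g x)

    inBlock? : ∀ x → Dec (Between H (f (source x)) (f (target x)) (g x))
    inBlock? x = between? H (f (source x)) (f (target x)) (g x)

    hom⇒ : IsHom E H (f V.++ g) → IsHom G H f × InBlocks
    hom⇒ hom = restrict , inBlocks
      where
      along : ∀ {y z a b} → y ≡ a → z ≡ b → T (arc H y z) → T (arc H a b)
      along = subst₂ (λ a b → T (arc H a b))
      restrict : IsHom G H f
      restrict a b ab = along (lookup-++ˡ f g a) (lookup-++ˡ f g b) (hom _ _ (old-arc a b ab))
      inBlocks : InBlocks
      inBlocks x = Equivalence.from T-∧
        ( along (lookup-++ˡ f g (source x)) (lookup-++ʳ f g x) (hom _ _ (arc-into x))
        , along (lookup-++ʳ f g x) (lookup-++ˡ f g (target x)) (hom _ _ (arc-out-of x)) )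

    hom⇐ : IsHom G H f → InBlocks → IsHom E H (f V.++ g)
    hom⇐ homf inBlocks y z yz with splitAt (n G) y | splitAt (n G) z
    ... | inj₁ a | inj₁ b = homf a b yz
    ... | inj₁ a | inj₂ x rewrite sound (a ≟ source x) yz =
      proj₁ (Equivalence.to T-∧ (inBlocks x))
    ... | inj₂ x | inj₁ b rewrite sound (b ≟ target x) yz =
      proj₂ (Equivalence.to T-∧ (inBlocks x))
    ... | inj₂ _ | inj₂ _ = ⊥-elim yz

    indicator-hom-++ : indicator (isHom? E H (f V.++ g)) ≡
      indicator (isHom? G H f) * ∏[ x < N ] indicator (inBlock? x)
    indicator-hom-++ = begin
      indicator (isHom? E H (f V.++ g))
        ≡⟨ indicator-⇔ (isHom? E H (f V.++ g)) (isHom? G H f ×-dec inBlocks?)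
                       hom⇒ (λ (homf , inB) → hom⇐ homf inB) ⟩
      indicator (isHom? G H f ×-dec inBlocks?)
        ≡⟨ indicator-× (isHom? G H f) inBlocks? ⟩
      indicator (isHom? G H f) * indicator inBlocks?
        ≡⟨ cong (indicator (isHom? G H f) *_) (sym (∏-indicator N inBlock? inBlocks?)) ⟩
      indicator (isHom? G H f) * ∏[ x < N ] indicator (inBlock? x) ∎
      where
      open ≡-Reasoning
      inBlocks? : Dec InBlocks
      inBlocks? = all? inBlock?

  -- The extensions of f to the new vertices number ∏_x ι(f v_x, f w_x) = π_α(f)^ν,
  -- since the block X_ν(v,w) has ν·α(v,w) vertices.
  extensions : (f : Fin (n G) → Fin (n H)) →
    ∏[ x < N ] ι H (f (source x)) (f (target x)) ≡ πα G H α f ^ ν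
  extensions f = begin
    ∏[ x < N ] ι H (f (source x)) (f (target x))
      ≡⟨ ∏-blocks (pairs (n G)) blockSize (λ p → ιξ G H f (proj₁ p) (proj₂ p)) ⟩
    product (map (λ p → ιξ G H f (proj₁ p) (proj₂ p) ^ blockSize p) (pairs (n G)))
      ≡⟨ cong product (map-cong block-power (pairs (n G))) ⟩
    product (map (λ p → contribution G H α f p ^ ν) (pairs (n G)))
      ≡⟨ product-^ (contribution G H α f) ν (pairs (n G)) ⟩
    product (map (contribution G H α f) (pairs (n G))) ^ ν
      ≡⟨ cong (_^ ν) (sym (πα-formula G H α f)) ⟩
    πα G H α f ^ ν ∎
    where
    open ≡-Reasoning
    block-power : ∀ p → ιξ G H f (proj₁ p) (proj₂ p) ^ blockSize p ≡ contribution G H α f p ^ ν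
    block-power (v , w) = trans (cong (ιξ G H f v w ^_) (*-comm ν (wt α v w)))
                                (sym (^-*-assoc (ιξ G H f v w) (wt α v w) ν))

  numHom-expand : numHom E H ≡ Σmaps (n G) (n H) (λ f → indicator (isHom? G H f) * πα G H α f ^ ν)
  numHom-expand = begin
    numHom E H
      ≡⟨ length-filter-indicator (isHom? E H) (allFuns (n G + N) (n H)) ⟩
    Σmaps (n G + N) (n H) (indicator ∘ isHom? E H)
      ≡⟨ Σmaps-++ (n G) N (n H) (indicator ∘ isHom? E H) (hom-indicator-extensional E H) ⟩
    Σmaps (n G) (n H) (λ f → Σmaps N (n H) (λ g → indicator (isHom? E H (f V.++ g))))
      ≡⟨ Σmaps-cong (n G) (n H) (λ f → trans (Σmaps-cong N (n H) (indicator-hom-++ f))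
                                              (Σmaps-*ˡ N (n H) (indicator (isHom? G H f)) _)) ⟩
    Σmaps (n G) (n H) (λ f → indicator (isHom? G H f) *
      Σmaps N (n H) (λ g → ∏[ x < N ] inBlock f x (g x)))
      ≡⟨ Σmaps-cong (n G) (n H) (λ f → cong (indicator (isHom? G H f) *_)
           (Σmaps-∏ N (n H) (inBlock f))) ⟩
    Σmaps (n G) (n H) (λ f → indicator (isHom? G H f) * ∏[ x < N ] ∑[ u < n H ] inBlock f x u)
      ≡⟨ Σmaps-cong (n G) (n H) (λ f → cong (indicator (isHom? G H f) *_)
           (trans (∏-cong N (λ x → sym (ι-as-sum H (f (source x)) (f (target x))))) (extensions f))) ⟩
    Σmaps (n G) (n H) (λ f → indicator (isHom? G H f) * πα G H α f ^ ν) ∎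
    where
    open ≡-Reasoning
    inBlock : (Fin (n G) → Fin (n H)) → Fin N → Fin (n H) → ℕ
    inBlock f x u = indicator (between? H (f (source x)) (f (target x)) u)

open ExpFunWithLeading

single-term : ∀ {f} a x → 0 < a → 0 < x → (∀ ν → f ν ≡ a * x ^ ν) → ExpFunWithLeading f a x
single-term a x a>0 x>0 f≡ = record
  { k         = 0
  ; coef      = λ _ → a
  ; base      = λ _ → x
  ; coef-pos  = λ _ → a>0
  ; base-pos  = λ _ → x>0
  ; base-inc  = λ { zero zero () }
  ; formula   = λ ν → trans (f≡ ν) (sym (+-identityʳ (a * x ^ ν)))
  ; lead-coef = refl
  ; lead-base = refl
  }

lower-term : ∀ {f g a x} c b → 0 < c → 0 < b →
  (E : ExpFunWithLeading g a x) → (∀ i → b < base E i) →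
  (∀ ν → f ν ≡ c * b ^ ν + g ν) → ExpFunWithLeading f a x
lower-term {g = g} c b c>0 b>0 E b<bases f≡ = record
  { k         = suc (k E)
  ; coef      = c V.∷ coef E
  ; base      = b V.∷ base E
  ; coef-pos  = λ { zero → c>0 ; (suc i) → coef-pos E i }
  ; base-pos  = λ { zero → b>0 ; (suc i) → base-pos E i }
  ; base-inc  = λ { zero zero () ; zero (suc j) _ → b<bases j ; (suc i) zero ()
                  ; (suc i) (suc j) (s≤s i<j) → base-inc E i j i<j }
  ; formula   = λ ν → begin
      _
        ≡⟨ f≡ ν ⟩
      c * b ^ ν + g ν
        ≡⟨ cong (c * b ^ ν +_) (formula E ν) ⟩
      c * b ^ ν + sum (map (λ i → coef E i * base E i ^ ν) (allFin (suc (k E))))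
        ≡⟨ cong (c * b ^ ν +_) (sum-allFin (suc (k E)) _) ⟩
      c * b ^ ν + ∑[ i < suc (k E) ] (coef E i * base E i ^ ν)
        ≡⟨ sym (sum-allFin (suc (suc (k E))) (λ i → (c V.∷ coef E) i * (b V.∷ base E) i ^ ν)) ⟩
      sum (map (λ i → (c V.∷ coef E) i * (b V.∷ base E) i ^ ν) (allFin (suc (suc (k E))))) ∎
  ; lead-coef = lead-coef E
  ; lead-base = lead-base E
  }
  where open ≡-Reasoning

transport-exp : ∀ {f g a a′ x} → (∀ ν → f ν ≡ g ν) → a ≡ a′ →
  ExpFunWithLeading g a x → ExpFunWithLeading f a′ x
transport-exp f≡g a≡a′ E = record
  { k = k E ; coef = coef E ; base = base E ; coef-pos = coef-pos E ; base-pos = base-pos E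
  ; base-inc = base-inc E ; formula = λ ν → trans (f≡g ν) (formula E ν)
  ; lead-coef = trans (lead-coef E) a≡a′ ; lead-base = lead-base E }

powerSum : List ℕ → ℕ → ℕ
powerSum L ν = sum (map (_^ ν) L)

multiplicity : ℕ → List ℕ → ℕ
multiplicity a L = length (filter (_≟ℕ a) L)

without : ℕ → List ℕ → List ℕ
without a = filter (λ x → ¬? (x ≟ℕ a))

module _ (a : ℕ) {x : ℕ} (L : List ℕ) where

  multiplicity-here : x ≡ a → multiplicity a (x ∷ L) ≡ suc (multiplicity a L)
  multiplicity-here x≡a = cong length (filter-accept (_≟ℕ a) x≡a)

  multiplicity-there : x ≢ a → multiplicity a (x ∷ L) ≡ multiplicity a L
  multiplicity-there x≢a = cong length (filter-reject (_≟ℕ a) x≢a)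

  without-here : x ≡ a → without a (x ∷ L) ≡ without a L
  without-here x≡a = filter-reject (λ y → ¬? (y ≟ℕ a)) (λ x≢a → x≢a x≡a)

  without-there : x ≢ a → without a (x ∷ L) ≡ x ∷ without a L
  without-there x≢a = filter-accept (λ y → ¬? (y ≟ℕ a)) x≢a

powerSum-split : ∀ a L ν → powerSum L ν ≡ multiplicity a L * a ^ ν + powerSum (without a L) ν
powerSum-split a []       ν = refl
powerSum-split a (x ∷ L) ν with x ≟ℕ a
... | yes refl = begin
  x ^ ν + powerSum L ν
    ≡⟨ cong (x ^ ν +_) (powerSum-split x L ν) ⟩
  x ^ ν + (multiplicity x L * x ^ ν + powerSum (without x L) ν)
    ≡⟨ sym (+-assoc (x ^ ν) _ _) ⟩
  suc (multiplicity x L) * x ^ ν + powerSum (without x L) ν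
    ≡⟨ cong₂ (λ c R → c * x ^ ν + powerSum R ν)
             (sym (multiplicity-here x L refl)) (sym (without-here x L refl)) ⟩
  multiplicity x (x ∷ L) * x ^ ν + powerSum (without x (x ∷ L)) ν ∎
  where open ≡-Reasoning
... | no x≢a = begin
  x ^ ν + powerSum L ν
    ≡⟨ cong (x ^ ν +_) (powerSum-split a L ν) ⟩
  x ^ ν + (multiplicity a L * a ^ ν + powerSum (without a L) ν)
    ≡⟨ +-left-comm (x ^ ν) (multiplicity a L * a ^ ν) (powerSum (without a L) ν) ⟩
  multiplicity a L * a ^ ν + powerSum (x ∷ without a L) ν
    ≡⟨ cong₂ (λ c R → c * a ^ ν + powerSum R ν)
             (sym (multiplicity-there a L x≢a)) (sym (without-there a L x≢a)) ⟩
  multiplicity a (x ∷ L) * a ^ ν + powerSum (without a (x ∷ L)) ν ∎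
  where
  open ≡-Reasoning
  +-left-comm : ∀ p q r → p + (q + r) ≡ q + (p + r)
  +-left-comm p q r = trans (sym (+-assoc p q r)) (trans (cong (_+ r) (+-comm p q)) (+-assoc q p r))

multiplicity-∷ : ∀ b x {L L′} → multiplicity b L′ ≡ multiplicity b L →
  multiplicity b (x ∷ L′) ≡ multiplicity b (x ∷ L)
multiplicity-∷ b x {L} {L′} eq with x ≟ℕ b
... | yes x≡b = trans (multiplicity-here b L′ x≡b) (trans (cong suc eq) (sym (multiplicity-here b L x≡b)))
... | no x≢b  = trans (multiplicity-there b L′ x≢b) (trans eq (sym (multiplicity-there b L x≢b)))

multiplicity-without : ∀ a b L → b ≢ a → multiplicity b (without a L) ≡ multiplicity b L
multiplicity-without a b []      b≢a = refl
multiplicity-without a b (x ∷ L) b≢a with x ≟ℕ a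
... | yes x≡a = begin
  multiplicity b (without a (x ∷ L)) ≡⟨ cong (multiplicity b) (without-here a L x≡a) ⟩
  multiplicity b (without a L)       ≡⟨ multiplicity-without a b L b≢a ⟩
  multiplicity b L                   ≡⟨ sym (multiplicity-there b L (λ x≡b → b≢a (trans (sym x≡b) x≡a))) ⟩
  multiplicity b (x ∷ L)             ∎
  where open ≡-Reasoning
... | no x≢a  = trans (cong (multiplicity b) (without-there a L x≢a))
                      (multiplicity-∷ b x (multiplicity-without a b L b≢a))

multiplicity-pos : ∀ {a L} → a ∈ L → 0 < multiplicity a L
multiplicity-pos a∈L = filter-some (_≟ℕ _) (Any.map sym a∈L)

-- Induction on the length: split off the copies of the minimum m of L; if m = M
-- nothing remains, otherwise the rest yields the higher terms and m a new lowest term.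
powerSum-exponential : ∀ bound (L : List ℕ) M → length L ≤ bound →
  All (0 <_) L → All (_≤ M) L → 0 < multiplicity M L →
  Σ[ E ∈ ExpFunWithLeading (powerSum L) (multiplicity M L) M ] (∀ i → base E i ∈ L)
powerSum-exponential bound       []       M _  _ _ ()
powerSum-exponential zero        (x ∷ ys) M () _ _ _
powerSum-exponential (suc bound) (x ∷ ys) M len≤ pos ≤M M-occurs =
  split-minimum (min x ys) (argmin-all id (here refl) (All.tabulate there))
                           (min≤⊤ x ys All.∷ min≤xs x ys)
  where
  L : List ℕ
  L = x ∷ ys
  split-minimum : ∀ m → m ∈ L → All (m ≤_) L →
    Σ[ E ∈ ExpFunWithLeading (powerSum L) (multiplicity M L) M ] (∀ i → base E i ∈ L)
  split-minimum m m∈L m≤L with m ≟ℕ M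
  ... | yes refl = single-term (multiplicity m L) m M-occurs (All.lookup pos m∈L) only-m , λ _ → m∈L
    where
    nothing-else : without m L ≡ []
    nothing-else = filter-none (λ y → ¬? (y ≟ℕ m))
      (All.zipWith (λ (m≤y , y≤m) y≢m → y≢m (≤-antisym y≤m m≤y)) (m≤L , ≤M))
    only-m : ∀ ν → powerSum L ν ≡ multiplicity m L * m ^ ν
    only-m ν = trans (powerSum-split m L ν)
      (trans (cong (λ R → multiplicity m L * m ^ ν + powerSum R ν) nothing-else) (+-identityʳ _))
  ... | no m≢M = transport-exp (λ _ → refl) same-multiplicity E , bases
    where
    not-m? : ∀ y → Dec (y ≢ m)
    not-m? y = ¬? (y ≟ℕ m)
    rest : List ℕ
    rest = without m L
    same-multiplicity : multiplicity M rest ≡ multiplicity M L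
    same-multiplicity = multiplicity-without m M L (λ M≡m → m≢M (sym M≡m))
    shorter : length rest ≤ bound
    shorter = ≤-pred (≤-trans (filter-notAll not-m? L m-removed) len≤)
      where
      m-removed : Any (λ y → ¬ (y ≢ m)) L
      m-removed = Any.map (λ m≡y y≢m → y≢m (sym m≡y)) m∈L
    higher : Σ[ E ∈ ExpFunWithLeading (powerSum rest) (multiplicity M rest) M ] (∀ i → base E i ∈ rest)
    higher = powerSum-exponential bound rest M shorter (filter⁺ not-m? pos) (filter⁺ not-m? ≤M)
               (subst (0 <_) (sym same-multiplicity) M-occurs)
    m<higher : ∀ i → m < base (proj₁ higher) i
    m<higher i with ∈-filter⁻ not-m? (proj₂ higher i)
    ... | b∈L , b≢m = ≤∧≢⇒< (All.lookup m≤L b∈L) (λ m≡b → b≢m (sym m≡b))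
    E : ExpFunWithLeading (powerSum L) (multiplicity M rest) M
    E = lower-term (multiplicity m L) m (multiplicity-pos m∈L) (All.lookup pos m∈L)
                   (proj₁ higher) m<higher (powerSum-split m L)
    bases : ∀ i → base (transport-exp (λ _ → refl) same-multiplicity E) i ∈ L
    bases zero    = m∈L
    bases (suc i) = proj₁ (∈-filter⁻ not-m? (proj₂ higher i))

-- Positivity of weights: over a reflexive H, an arc ab has a ∈ [a,b]_H, so every
-- homomorphism ξ : G → H has π_α(ξ) > 0.
ι-pos : (H : Digraph) → Reflexive H → ∀ a b → T (arc H a b) → 0 < ι H a b
ι-pos H loops a b ab =
  filter-some (between? H a b) (Any.map (λ { refl → Equivalence.from T-∧ (loops a , ab) }) (∈-allFin a))

product-pos : {A : Set} (F : A → ℕ) (xs : List A) → (∀ x → 0 < F x) → 0 < product (map F xs)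
product-pos F []       F>0 = z<s
product-pos F (x ∷ xs) F>0 = *-mono-≤ (F>0 x) (product-pos F xs F>0)

πα-pos : (G H : Digraph) → Reflexive H → (α : ArcWeight G) (ξ : Fin (n G) → Fin (n H)) →
  IsHom G H ξ → 0 < πα G H α ξ
πα-pos G H loops α ξ homξ = subst (0 <_) (sym (πα-formula G H α ξ))
  (product-pos (contribution G H α ξ) (pairs (n G)) contribution-pos)
  where
  contribution-pos : ∀ p → 0 < contribution G H α ξ p
  contribution-pos (v , w) with wt α v w in eq
  ... | zero  = z<s
  ... | suc k = m^n>0 (ιξ G H ξ v w) {{>-nonZero (ι-pos H loops (ξ v) (ξ w) (homξ v w arc-vw))}} (suc k)
    where
    arc-vw : T (arc G v w)
    arc-vw = proj₁ (Equivalence.to T-∧ (support α v w (subst (0 <_) (sym eq) z<s)))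

Agree-resp : (G H : Digraph) (α : ArcWeight G) {f g : Fin (n G) → Fin (n H)}
  (ζ : Fin (n G) → Fin (n H)) → (∀ x → f x ≡ g x) → Agree G H α f ζ → Agree G H α g ζ
Agree-resp G H α ζ f≗g agree v w α>0 =
  trans (cong₂ (ι H) (sym (f≗g v)) (sym (f≗g w))) (agree v w α>0)

module Corollary (G H : Digraph) (loops : Reflexive H) (ζ : Fin (n G) → Fin (n H)) (homζ : IsHom G H ζ)
                 (α : ArcWeight G) (selecting : Selecting G H α ζ) where

  maps : List (Fin (n G) → Fin (n H))
  maps = allFuns (n G) (n H)

  weights : List ℕ
  weights = map (πα G H α) (filter (isHom? G H) maps)

  numHom≡powerSum : ∀ ν → numHom (expand G α ν) H ≡ powerSum weights ν
  numHom≡powerSum ν = trans (Expansion.numHom-expand G H α ν)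
                            (sym (sum-filter (isHom? G H) (πα G H α) (_^ ν) maps))

  weights-pos : All (0 <_) weights
  weights-pos = All-map⁺ (All.map (πα-pos G H loops α _) (all-filter (isHom? G H) maps))

  weights≤ : All (_≤ πα G H α ζ) weights
  weights≤ = All-map⁺ (All.map (λ {ξ} homξ → proj₁ (selecting ξ homξ))
                               (all-filter (isHom? G H) maps))

  multiplicity≡iζ : multiplicity (πα G H α ζ) weights ≡ iζ G H α ζ
  multiplicity≡iζ = begin
    multiplicity (πα G H α ζ) weights
      ≡⟨ length-filter-indicator (_≟ℕ πα G H α ζ) weights ⟩
    sum (map (indicator ∘ (_≟ℕ πα G H α ζ)) weights)
      ≡⟨ sum-filter (isHom? G H) (πα G H α) (indicator ∘ (_≟ℕ πα G H α ζ)) maps ⟩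
    sum (map (λ ξ → indicator (isHom? G H ξ) * indicator (πα G H α ξ ≟ℕ πα G H α ζ)) maps)
      ≡⟨ cong sum (map-cong top-weight⇔agree maps) ⟩
    sum (map (indicator ∘ selected?) maps)
      ≡⟨ sym (length-filter-indicator selected? maps) ⟩
    iζ G H α ζ ∎
    where
    open ≡-Reasoning
    selected? : ∀ ξ → Dec (IsHom G H ξ × Agree G H α ξ ζ)
    selected? ξ = isHom? G H ξ ×-dec agree? G H α ξ ζ
    top-weight⇔agree : ∀ ξ → indicator (isHom? G H ξ) * indicator (πα G H α ξ ≟ℕ πα G H α ζ)
                           ≡ indicator (selected? ξ)
    top-weight⇔agree ξ = trans (sym (indicator-× (isHom? G H ξ) (πα G H α ξ ≟ℕ πα G H α ζ)))
      (indicator-⇔ (isHom? G H ξ ×-dec (πα G H α ξ ≟ℕ πα G H α ζ)) (selected? ξ)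
        (λ (homξ , top) → homξ , proj₁ (proj₂ (selecting ξ homξ)) top)
        (λ (homξ , agree) → homξ , proj₂ (proj₂ (selecting ξ homξ)) agree))

  -- ζ itself (up to pointwise equality) is counted by i_ζ, so the top weight occurs.
  top-occurs : 0 < multiplicity (πα G H α ζ) weights
  top-occurs = subst (0 <_) (sym multiplicity≡iζ) iζ-pos
    where
    iζ-pos : 0 < iζ G H α ζ
    iζ-pos = filter-some (λ ξ → isHom? G H ξ ×-dec agree? G H α ξ ζ)
      (Any.map (λ ξ≗ζ → IsHom-resp G H (sym ∘ ξ≗ζ) homζ
                       , Agree-resp G H α ζ (sym ∘ ξ≗ζ) (λ _ _ _ → refl))
               (allFuns-complete (n G) (n H) ζ))

corollary1 : (G H : Digraph) → Reflexive H →
    (ζ : Fin (n G) → Fin (n H)) → IsHom G H ζ →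
    (α : ArcWeight G) → Selecting G H α ζ →
    ExpFunWithLeading (λ ν → numHom (expand G α ν) H) (iζ G H α ζ) (πα G H α ζ)
corollary1 G H loops ζ homζ α selecting =
  transport-exp numHom≡powerSum multiplicity≡iζ
    (proj₁ (powerSum-exponential (length weights) weights (πα G H α ζ)
                                 ≤-refl weights-pos weights≤ top-occurs))
  where open Corollary G H loops ζ homζ α selecting
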